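{- For $n\ge 1$, $a_n(12;2\to 2)=n!-d_n$, where $d_n$ is the $n$-th derangement number.
   Context: Standard cycle form of $\sigma\in S_n$: product of disjoint cycles (fixed points included), each cycle starting with its largest element, cycles listed in increasing order of largest elements. The fundamental bijection $\theta:S_n\to S_n$ erases the parentheses of the standard cycle form to give a one-line permutation. For $\pi\in S_n$, $\hat\pi=\theta^{ -1}(\pi)$. An arrow pattern $(\nu;H)$ of size $k$: a string $\nu=a_1\dots a_m$ of positive integers and a set $H$ of arrows $b\to c$, with all integers appearing forming $[k]$. $\pi\in S_n$ contains $(\nu;H)$ if there is $X=\{x_1<\dots<x_k\}\subseteq[n]$ with positions $t_1<\dots<t_m$ such that $\pi_{t_1}\cdots\pi_{t_m}=x_{a_1}\cdots x_{a_m}$ and $\hat\pi(x_b)=x_c$ for every arrow $b\to c\in H$; otherwise it avoids it. $a_n(\nu;H)$ = number of $\pi\in S_n$ avoiding $(\nu;H)$. $d_n$ = number of fixed-point-free permutations of $[n]$. So $(12;2\to2)$ is the size-2 pattern: $x_1<x_2$ with $x_1$ appearing before $x_2$ in $\pi$ and $\hat\pi(x_2)=x_2$. -}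

module Defs where

-- Permutations of [n] = {1,…,n} are represented in one-line notation as
-- lists  π₁ π₂ … πₙ  of natural numbers.  Everything below is computable
-- (Bool-valued) so that counts are given by filtering explicit enumerations.

open import Data.Nat using (ℕ; zero; suc; _+_; _∸_; _≡ᵇ_; _<ᵇ_; _≤ᵇ_)
open import Data.Bool using (Bool; true; false; _∧_; _∨_; not; if_then_else_)
open import Data.List using (List; []; _∷_; _++_; map; length; concatMap; upTo; zipWith)
open import Data.Product using (_×_; _,_)
open import Relation.Binary.PropositionalEquality using (_≡_)

range : ℕ → List ℕ
range n = map suc (upTo n)

elem : ℕ → List ℕ → Bool
elem x [] = false
elem x (y ∷ ys) = (x ≡ᵇ y) ∨ elem x ys

allᵇ : {A : Set} → (A → Bool) → List A → Bool
allᵇ p [] = true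
allᵇ p (x ∷ xs) = p x ∧ allᵇ p xs

anyᵇ : {A : Set} → (A → Bool) → List A → Bool
anyᵇ p [] = false
anyᵇ p (x ∷ xs) = p x ∨ anyᵇ p xs

andᵇ : List Bool → Bool
andᵇ = allᵇ (λ b → b)

takeWhileᵇ : {A : Set} → (A → Bool) → List A → List A
takeWhileᵇ p [] = []
takeWhileᵇ p (x ∷ xs) = if p x then x ∷ takeWhileᵇ p xs else []

distinct : List ℕ → Bool
distinct [] = true
distinct (x ∷ xs) = not (elem x xs) ∧ distinct xs

words : ℕ → List ℕ → List (List ℕ)
words zero A = [] ∷ []
words (suc k) A = concatMap (λ a → map (a ∷_) (words k A)) A

filterᵇ : {A : Set} → (A → Bool) → List A → List A
filterᵇ p [] = []
filterᵇ p (x ∷ xs) = if p x then x ∷ filterᵇ p xs else filterᵇ p xs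

Sym : ℕ → List (List ℕ)
Sym n = filterᵇ distinct (words n (range n))

-- 1-based lookup: π(i) = i-th entry (0 if out of range; never used then)
at : List ℕ → ℕ → ℕ
at [] i = 0
at (x ∷ xs) zero = 0
at (x ∷ xs) (suc zero) = x
at (x ∷ xs) (suc (suc i)) = at xs (suc i)

iter : List ℕ → ℕ → ℕ → List ℕ
iter σ zero m = []
iter σ (suc k) m = at σ m ∷ iter σ k (at σ m)

cycleFrom : ℕ → List ℕ → ℕ → List ℕ
cycleFrom n σ m = m ∷ takeWhileᵇ (λ y → not (y ≡ᵇ m)) (iter σ n m)

isCycleMax : ℕ → List ℕ → ℕ → Bool
isCycleMax n σ m = allᵇ (λ y → y ≤ᵇ m) (cycleFrom n σ m)

standardCycles : ℕ → List ℕ → List (List ℕ)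
standardCycles n σ = map (cycleFrom n σ) (filterᵇ (isCycleMax n σ) (range n))

θ : ℕ → List ℕ → List ℕ
θ n σ = concatMap (λ c → c) (standardCycles n σ)

isHat : ℕ → List ℕ → List ℕ → Bool
isHat n π σ = andᵇ (zipWith _≡ᵇ_ (θ n σ) π) ∧ (length (θ n σ) ≡ᵇ length π)

record ArrowPattern : Set where
  constructor mkPattern
  field
    size   : ℕ
    word   : List ℕ
    arrows : List (ℕ × ℕ)      -- H, an arrow b → c is the pair (b , c)

-- strictly increasing lists of length k with entries in [n]
-- (subsets {x₁ < … < x_k} of [n], and position tuples t₁ < … < t_m)
increasing : List ℕ → Bool
increasing [] = true
increasing (x ∷ []) = true
increasing (x ∷ y ∷ ys) = (x <ᵇ y) ∧ increasing (y ∷ ys)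

subsetsOf : ℕ → ℕ → List (List ℕ)
subsetsOf k n = filterᵇ increasing (words k (range n))

-- π ∈ S_n contains (ν;H): there are X = {x₁<…<x_k} ⊆ [n] and positions
-- t₁<…<t_m with π_{t_j} = x_{a_j} for all j, and π̂(x_b) = x_c for b→c ∈ H.
-- Here π̂ is the unique σ ∈ S_n with θ(σ) = π.
containsᵇ : ℕ → ArrowPattern → List ℕ → Bool
containsᵇ n (mkPattern k ν H) π =
  anyᵇ (λ σ → isHat n π σ ∧
        anyᵇ (λ X →
           anyᵇ (λ T → andᵇ (zipWith (λ t a → at π t ≡ᵇ at X a) T ν))
               (subsetsOf (length ν) n)
           ∧ allᵇ (λ { (b , c) → at σ (at X b) ≡ᵇ at X c }) H)
          (subsetsOf k n))
      (Sym n)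

avoidsᵇ : ℕ → ArrowPattern → List ℕ → Bool
avoidsᵇ n p π = not (containsᵇ n p π)

a : ArrowPattern → ℕ → ℕ
a p n = length (filterᵇ (avoidsᵇ n p) (Sym n))

fixedPointFree : ℕ → List ℕ → Bool
fixedPointFree n π = allᵇ (λ i → not (at π i ≡ᵇ i)) (range n)

d : ℕ → ℕ
d n = length (filterᵇ (fixedPointFree n) (Sym n))

p12-2→2 : ArrowPattern
p12-2→2 = mkPattern 2 (1 ∷ 2 ∷ []) ((2 , 2) ∷ [])

{-# OPTIONS --safe #-}
module Submission where

-- Write π̂ = θ⁻¹(π). By the definition of θ, the cycles of π̂ in standard form
-- are the segments ("blocks") of π that begin at its left-to-right maxima, so
-- π contains (12; 2→2) exactly when some block other than the first is a
-- singleton [v]: v is then a fixed point of π̂ preceded by the smaller first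
-- entry of π. Moving the last such v to the front of π merges all blocks
-- before it into the single block v ∷ …, and splitting the first block of a
-- permutation without singleton blocks undoes this. So the permutations
-- containing the pattern are equinumerous with those without singleton
-- blocks, which θ⁻¹ maps bijectively onto the derangements: n! − a_n = d_n.
-- For n = 0 the empty permutation has no block to split, hence n ≥ 1.

open import Defs
open import Data.Bool using (Bool; true; false; T; not; _∧_; _∨_; if_then_else_)
open import Data.Bool.ListAction using (any; all)
open import Data.Bool.Properties using (T-∧; T-∨; T-≡; T-not-≡)
open import Data.Empty using (⊥-elim)
open import Data.List
  using (List; []; _∷_; [_]; _++_; map; concat; concatMap; length; filter; upTo; applyUpTo; drop; zipWith)
open import Data.List.Membership.Propositional using (_∈_; _∉_; find; lose)
open import Data.List.Membership.Propositional.Properties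
  using ( ∈-filter⁺; ∈-filter⁻; ∈-map⁺; ∈-map⁻; ∈-++⁺ˡ; ∈-++⁺ʳ; ∈-∃++
        ; ∈-concatMap⁺; ∈-concatMap⁻; ∈-concat⁺′; ∈-concat⁻′; ∈-upTo⁺; ∈-upTo⁻ )
open import Data.List.Properties
  using ( ≡-dec; length-map; length-++; length-filter; length-upTo; filter-++; filter-notAll
        ; ∷-injectiveˡ; ∷-injectiveʳ; ++-assoc; ++-identityʳ; map-∘; map-++; map-id; map-id-local
        ; map-applyUpTo; concat-++ )
open import Data.List.Relation.Binary.Disjoint.Propositional using (Disjoint)
open import Data.List.Relation.Binary.Permutation.Propositional
  using (_↭_; ↭-refl; ↭-sym; ↭-trans; prep; ↭⇒↭ₛ; module PermutationReasoning)
open import Data.List.Relation.Binary.Permutation.Propositional.Properties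
  using (∈-resp-↭; ↭-length; shift; ∷↭∷ʳ; ++-comm; ↭-singleton-inv)
  renaming (map⁺ to map-↭; ++⁺ to ++-↭)
import Data.List.Relation.Binary.Permutation.Setoid.Properties as ↭ₛ
open import Data.List.Relation.Binary.Pointwise using (Pointwise-≡⇒≡)
open import Data.List.Relation.Binary.Subset.Propositional using (_⊆_)
open import Data.List.Relation.Unary.All as All using (All; []; _∷_)
import Data.List.Relation.Unary.All.Properties as All
open import Data.List.Relation.Unary.All.Properties using (all⁺; all⁻; ¬Any⇒All¬; All¬⇒¬Any)
open import Data.List.Relation.Unary.AllPairs as AllPairs using (AllPairs; []; _∷_)
import Data.List.Relation.Unary.AllPairs.Properties as AllPairs
open import Data.List.Relation.Unary.Any as Any using (Any; here; there)
open import Data.List.Relation.Unary.Any.Properties using (any⁺; any⁻)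
open import Data.List.Relation.Unary.Sorted.TotalOrder.Properties using (↗↭↗⇒≋; AllPairs⇒Sorted)
open import Data.List.Relation.Unary.Unique.Propositional using (Unique)
import Data.List.Relation.Unary.Unique.Propositional.Properties as Unique
open import Data.Nat
  using (ℕ; zero; suc; _+_; _∸_; _*_; _!; _≤_; _<_; _≡ᵇ_; _<ᵇ_; _≤ᵇ_; _≟_; z≤n; s≤s; s<s)
open import Data.Nat.Properties
open import Data.Product as Product using (_×_; _,_; proj₁; proj₂; ∃; ∃₂)
open import Data.Sum using (inj₁; inj₂)
open import Function using (_∘_; id; _⇔_; mk⇔; Equivalence)
open import Relation.Binary.Definitions using (DecidableEquality)
open import Relation.Binary.PropositionalEquality hiding ([_])
open import Relation.Nullary using (¬_; yes; no; contradiction; ¬?)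
open import Relation.Nullary.Decidable using (T?)
open import Relation.Nullary.Reflects using (ofʸ; ofⁿ)

private
  variable
    A : Set
    x : A
    xs ys : List A
    p : A → Bool

-- Boolean list operations

filterᵇ≗filter : (p : A → Bool) → filterᵇ p ≗ filter (T? ∘ p)
filterᵇ≗filter p [] = refl
filterᵇ≗filter p (x ∷ xs) with p x
... | true  = cong (x ∷_) (filterᵇ≗filter p xs)
... | false = filterᵇ≗filter p xs

∈-filterᵇ⁺ : x ∈ xs → T (p x) → x ∈ filterᵇ p xs
∈-filterᵇ⁺ {xs = xs} {p = p} x∈ px = subst (_ ∈_) (sym (filterᵇ≗filter p xs)) (∈-filter⁺ (T? ∘ p) x∈ px)

∈-filterᵇ⁻ : x ∈ filterᵇ p xs → x ∈ xs × T (p x)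
∈-filterᵇ⁻ {p = p} {xs = xs} x∈ = ∈-filter⁻ (T? ∘ p) (subst (_ ∈_) (filterᵇ≗filter p xs) x∈)

Unique-filterᵇ : Unique xs → Unique (filterᵇ p xs)
Unique-filterᵇ {xs = xs} {p = p} u = subst Unique (sym (filterᵇ≗filter p xs)) (Unique.filter⁺ (T? ∘ p) u)

anyᵇ≗any : (p : A → Bool) → anyᵇ p ≗ any p
anyᵇ≗any p []       = refl
anyᵇ≗any p (x ∷ xs) = cong (p x ∨_) (anyᵇ≗any p xs)

allᵇ≗all : (p : A → Bool) → allᵇ p ≗ all p
allᵇ≗all p []       = refl
allᵇ≗all p (x ∷ xs) = cong (p x ∧_) (allᵇ≗all p xs)

anyᵇ⁺ : Any (T ∘ p) xs → T (anyᵇ p xs)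
anyᵇ⁺ {p = p} {xs = xs} h = subst T (sym (anyᵇ≗any p xs)) (any⁺ p h)

anyᵇ⁻ : T (anyᵇ p xs) → Any (T ∘ p) xs
anyᵇ⁻ {p = p} {xs = xs} h = any⁻ p xs (subst T (anyᵇ≗any p xs) h)

allᵇ⁺ : All (T ∘ p) xs → T (allᵇ p xs)
allᵇ⁺ {p = p} {xs = xs} h = subst T (sym (allᵇ≗all p xs)) (all⁻ p h)

allᵇ⁻ : T (allᵇ p xs) → All (T ∘ p) xs
allᵇ⁻ {p = p} {xs = xs} h = all⁺ p xs (subst T (allᵇ≗all p xs) h)

T-not : ∀ {b} → T (not b) ⇔ (¬ T b)
T-not {true}  = mk⇔ (λ ()) (λ ¬t → ¬t _)
T-not {false} = mk⇔ (λ _ ()) _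

T-injective : ∀ {a b} → T a ⇔ T b → a ≡ b
T-injective {false} {false} _   = refl
T-injective {false} {true}  a⇔b = ⊥-elim (Equivalence.from a⇔b _)
T-injective {true}  {false} a⇔b = ⊥-elim (Equivalence.to a⇔b _)
T-injective {true}  {true}  _   = refl

≡ᵇ-refl : ∀ x → (x ≡ᵇ x) ≡ true
≡ᵇ-refl x = Equivalence.to T-≡ (≡⇒≡ᵇ x x refl)

≢⇒≡ᵇ≡false : ∀ {x y} → x ≢ y → (x ≡ᵇ y) ≡ false
≢⇒≡ᵇ≡false {x} {y} x≢y = Equivalence.to T-not-≡ (Equivalence.from T-not (x≢y ∘ ≡ᵇ⇒≡ x y))

elem⁺ : ∀ {x : ℕ} {xs} → x ∈ xs → T (elem x xs)
elem⁺ {x} (here refl) = Equivalence.from T-∨ (inj₁ (≡⇒≡ᵇ x x refl))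
elem⁺ (there x∈xs)    = Equivalence.from T-∨ (inj₂ (elem⁺ x∈xs))

elem⁻ : ∀ {x : ℕ} {xs} → T (elem x xs) → x ∈ xs
elem⁻ {x} {y ∷ ys} h with Equivalence.to T-∨ h
... | inj₁ x≡y  = here (≡ᵇ⇒≡ x y x≡y)
... | inj₂ x∈ys = there (elem⁻ x∈ys)

∈⇒elem≡true : ∀ {x : ℕ} {xs} → x ∈ xs → elem x xs ≡ true
∈⇒elem≡true = Equivalence.to T-≡ ∘ elem⁺

∉⇒elem≡false : ∀ {x : ℕ} {xs} → x ∉ xs → elem x xs ≡ false
∉⇒elem≡false x∉ = Equivalence.to T-not-≡ (Equivalence.from T-not (x∉ ∘ elem⁻))

distinct⁺ : ∀ {xs} → Unique xs → T (distinct xs)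
distinct⁺ []                 = _
distinct⁺ {x ∷ xs} (x∉ ∷ u) =
  Equivalence.from T-∧ (Equivalence.from T-not (All¬⇒¬Any x∉ ∘ elem⁻) , distinct⁺ u)

distinct⁻ : ∀ {xs} → T (distinct xs) → Unique xs
distinct⁻ {[]}     _ = []
distinct⁻ {x ∷ xs} h with x∉ , u ← Equivalence.to T-∧ h =
  ¬Any⇒All¬ xs (Equivalence.to T-not x∉ ∘ elem⁺) ∷ distinct⁻ u

filterᵇ-++ : ∀ (p : A → Bool) xs ys → filterᵇ p (xs ++ ys) ≡ filterᵇ p xs ++ filterᵇ p ys
filterᵇ-++ p xs ys = begin
  filterᵇ p (xs ++ ys)                     ≡⟨ filterᵇ≗filter p (xs ++ ys) ⟩
  filter (T? ∘ p) (xs ++ ys)               ≡⟨ filter-++ (T? ∘ p) xs ys ⟩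
  filter (T? ∘ p) xs ++ filter (T? ∘ p) ys ≡⟨ sym (cong₂ _++_ (filterᵇ≗filter p xs) (filterᵇ≗filter p ys)) ⟩
  filterᵇ p xs ++ filterᵇ p ys             ∎
  where open ≡-Reasoning

filterᵇ-map : ∀ {B : Set} (p : B → Bool) (f : A → B) xs → filterᵇ p (map f xs) ≡ map f (filterᵇ (p ∘ f) xs)
filterᵇ-map p f []       = refl
filterᵇ-map p f (x ∷ xs) with p (f x)
... | true  = cong (f x ∷_) (filterᵇ-map p f xs)
... | false = filterᵇ-map p f xs

filterᵇ-cong : ∀ {p q : A → Bool} xs → (∀ {x} → x ∈ xs → p x ≡ q x) → filterᵇ p xs ≡ filterᵇ q xs
filterᵇ-cong                 []       _   = refl
filterᵇ-cong {p = p} {q = q} (x ∷ xs) p≡q with p x | q x | p≡q (here refl)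
... | true  | true  | _ = cong (x ∷_) (filterᵇ-cong xs (p≡q ∘ there))
... | false | false | _ = filterᵇ-cong xs (p≡q ∘ there)

takeWhileᵇ-++ : ∀ (p : A → Bool) {z r} t → All (T ∘ p) t → ¬ T (p z) → takeWhileᵇ p (t ++ z ∷ r) ≡ t
takeWhileᵇ-++ p {z} []      _         ¬pz with p z
... | true  = contradiction _ ¬pz
... | false = refl
takeWhileᵇ-++ p (y ∷ t) (py ∷ pt) ¬pz with p y
... | true  = cong (y ∷_) (takeWhileᵇ-++ p t pt ¬pz)
... | false = ⊥-elim py

-- Lists without repetition and counting

Unique-resp-↭ : ∀ {xs ys : List A} → xs ↭ ys → Unique xs → Unique ys
Unique-resp-↭ = ↭ₛ.Unique-resp-↭ (setoid _) ∘ ↭⇒↭ₛ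

Unique-++⁻ : ∀ (xs : List A) {ys} → Unique (xs ++ ys) → Unique xs × Unique ys × Disjoint xs ys
Unique-++⁻ []       u          = [] , u , λ ()
Unique-++⁻ (x ∷ xs) (x≢ ∷ u) with uxs , uys , disjoint ← Unique-++⁻ xs u =
  All.++⁻ˡ xs x≢ ∷ uxs , uys ,
  λ { (here refl , z∈ys)  → All¬⇒¬Any (All.++⁻ʳ xs x≢) z∈ys
    ; (there z∈xs , z∈ys) → disjoint (z∈xs , z∈ys) }

Unique-concat-∈ : ∀ {b} {bs : List (List A)} → Unique (concat bs) → b ∈ bs → Unique b
Unique-concat-∈ {bs = b ∷ _} u (here refl) = proj₁ (Unique-++⁻ b u)
Unique-concat-∈ {bs = c ∷ _} u (there b∈)  = Unique-concat-∈ (proj₁ (proj₂ (Unique-++⁻ c u))) b∈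

Unique-map-leftInverse : ∀ {xs : List A} (f g : A → A) → Unique xs → (∀ {x} → x ∈ xs → g (f x) ≡ x) →
  Unique (map f xs)
Unique-map-leftInverse {xs = xs} f g u g∘f≡id =
  Unique.map⁻ {f = g} (subst Unique (sym (trans (sym (map-∘ xs)) (map-id-local (All.tabulate g∘f≡id)))) u)

Unique-⊆-⊇⇒↭ : Unique xs → Unique ys → xs ⊆ ys → ys ⊆ xs → xs ↭ ys
Unique-⊆-⊇⇒↭ {xs = []} {ys = []}    _ _ _ _   = ↭-refl
Unique-⊆-⊇⇒↭ {xs = []} {ys = _ ∷ _} _ _ _ ys⊆ with () ← ys⊆ (here refl)
Unique-⊆-⊇⇒↭ {xs = x ∷ xs} (x∉xs ∷ uxs) uys xs⊆ ys⊆ with ys₁ , ys₂ , refl ← ∈-∃++ (xs⊆ (here refl)) =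
  ↭-trans (prep x (Unique-⊆-⊇⇒↭ uxs urest sub sup)) (↭-sym (shift x ys₁ ys₂))
  where
    u′ : Unique (x ∷ ys₁ ++ ys₂)
    u′ = Unique-resp-↭ (shift x ys₁ ys₂) uys
    urest : Unique (ys₁ ++ ys₂)
    urest = AllPairs.tail u′
    sub : xs ⊆ ys₁ ++ ys₂
    sub z∈xs with ∈-resp-↭ (shift x ys₁ ys₂) (xs⊆ (there z∈xs))
    ... | here refl = contradiction z∈xs (All¬⇒¬Any x∉xs)
    ... | there z∈  = z∈
    sup : ys₁ ++ ys₂ ⊆ xs
    sup z∈rest with ys⊆ (∈-resp-↭ (↭-sym (shift x ys₁ ys₂)) (there z∈rest))
    ... | here refl = contradiction z∈rest (Unique.Unique[x∷xs]⇒x∉xs u′)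
    ... | there z∈  = z∈

strictlySorted-≡ : ∀ {xs ys : List ℕ} → AllPairs _<_ xs → AllPairs _<_ ys → xs ⊆ ys → ys ⊆ xs → xs ≡ ys
strictlySorted-≡ xs< ys< xs⊆ys ys⊆xs = Pointwise-≡⇒≡ (↗↭↗⇒≋ ≤-totalOrder
  (AllPairs⇒Sorted ≤-totalOrder (AllPairs.map <⇒≤ xs<)) (AllPairs⇒Sorted ≤-totalOrder (AllPairs.map <⇒≤ ys<))
  (↭⇒↭ₛ (Unique-⊆-⊇⇒↭ (AllPairs.map <⇒≢ xs<) (AllPairs.map <⇒≢ ys<) xs⊆ys ys⊆xs)))

length-filterᵇ-not : (p : A → Bool) (xs : List A) →
  length (filterᵇ p xs) + length (filterᵇ (not ∘ p) xs) ≡ length xs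
length-filterᵇ-not p []       = refl
length-filterᵇ-not p (x ∷ xs) with p x
... | true  = cong suc (length-filterᵇ-not p xs)
... | false = trans (+-suc _ _) (cong suc (length-filterᵇ-not p xs))

length-filterᵇ-concatMap : ∀ {B : Set} (p : B → Bool) (g : A → List B) {c} xs →
  (∀ {x} → x ∈ xs → length (filterᵇ p (g x)) ≡ c) → length (filterᵇ p (concatMap g xs)) ≡ length xs * c
length-filterᵇ-concatMap p g []       _ = refl
length-filterᵇ-concatMap p g (x ∷ xs) h = begin
  length (filterᵇ p (g x ++ concatMap g xs))                     ≡⟨ cong length (filterᵇ-++ p (g x) _) ⟩
  length (filterᵇ p (g x) ++ filterᵇ p (concatMap g xs))         ≡⟨ length-++ (filterᵇ p (g x)) ⟩
  length (filterᵇ p (g x)) + length (filterᵇ p (concatMap g xs)) ≡⟨ cong₂ _+_ (h (here refl))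
                                                                      (length-filterᵇ-concatMap p g xs (h ∘ there)) ⟩
  _ + length xs * _                                              ∎
  where open ≡-Reasoning

module _ {A : Set} (_≟_ : DecidableEquality A) where
  open import Data.List.Membership.DecPropositional _≟_ using (_∈?_)

  private
    ↭-filter-∈ : ∀ {xs ys : List A} → Unique xs → Unique ys → xs ⊆ ys → xs ↭ filter (_∈? xs) ys
    ↭-filter-∈ {xs = xs} {ys = ys} uxs uys xs⊆ys =
      Unique-⊆-⊇⇒↭ uxs (Unique.filter⁺ (_∈? xs) uys)
        (λ z∈xs → ∈-filter⁺ (_∈? xs) (xs⊆ys z∈xs) z∈xs) (proj₂ ∘ ∈-filter⁻ (_∈? xs) {xs = ys})

  Unique-⊆⇒length≤ : ∀ {xs ys : List A} → Unique xs → Unique ys → xs ⊆ ys → length xs ≤ length ys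
  Unique-⊆⇒length≤ {xs = xs} {ys = ys} uxs uys xs⊆ys =
    ≤-trans (≤-reflexive (↭-length (↭-filter-∈ uxs uys xs⊆ys))) (length-filter (_∈? xs) ys)

  Unique-⊆-length≥⇒⊇ : ∀ {xs ys : List A} → Unique xs → Unique ys → xs ⊆ ys →
    length ys ≤ length xs → ys ⊆ xs
  Unique-⊆-length≥⇒⊇ {xs = xs} {ys = ys} uxs uys xs⊆ys |ys|≤|xs| {y} y∈ys with y ∈? xs
  ... | yes y∈xs = y∈xs
  ... | no  y∉xs = contradiction |ys|≤|xs| (<⇒≱ (begin-strict
      length xs                   ≡⟨ ↭-length (↭-filter-∈ uxs uys xs⊆ys) ⟩
      length (filter (_∈? xs) ys) <⟨ filter-notAll (_∈? xs) ys (Any.map (λ { refl → y∉xs }) y∈ys) ⟩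
      length ys                   ∎))
    where open ≤-Reasoning

  leftInverse⇒length≤ : ∀ {xs ys : List A} (f g : A → A) → Unique xs → Unique ys →
    (∀ {x} → x ∈ xs → f x ∈ ys) → (∀ {x} → x ∈ xs → g (f x) ≡ x) → length xs ≤ length ys
  leftInverse⇒length≤ {xs} {ys} f g uxs uys f∈ g∘f≡id = begin
    length xs         ≡⟨ sym (length-map f xs) ⟩
    length (map f xs) ≤⟨ Unique-⊆⇒length≤ (Unique-map-leftInverse f g uxs g∘f≡id) uys image⊆ ⟩
    length ys         ∎
    where
      open ≤-Reasoning
      image⊆ : map f xs ⊆ ys
      image⊆ y∈ with x , x∈ , refl ← ∈-map⁻ f y∈ = f∈ x∈

  inverse⇒length≡ : ∀ {xs ys : List A} (f g : A → A) → Unique xs → Unique ys →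
    (∀ {x} → x ∈ xs → f x ∈ ys) → (∀ {y} → y ∈ ys → g y ∈ xs) →
    (∀ {x} → x ∈ xs → g (f x) ≡ x) → (∀ {y} → y ∈ ys → f (g y) ≡ y) → length xs ≡ length ys
  inverse⇒length≡ f g uxs uys f∈ g∈ g∘f≡id f∘g≡id =
    ≤-antisym (leftInverse⇒length≤ f g uxs uys f∈ g∘f≡id) (leftInverse⇒length≤ g f uys uxs g∈ f∘g≡id)

  -- f maps the (q ∘ f)-part of xs injectively into the q-part and the complement into the
  -- complement; as both pairs of parts partition xs, the two inequalities are equalities.
  length-filterᵇ-∘ : ∀ {xs : List A} (f g : A → A) (q : A → Bool) → Unique xs →
    (∀ {x} → x ∈ xs → f x ∈ xs) → (∀ {x} → x ∈ xs → g (f x) ≡ x) →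
    length (filterᵇ (q ∘ f) xs) ≡ length (filterᵇ q xs)
  length-filterᵇ-∘ {xs} f g q u f∈ g∘f≡id = ≤-antisym (≤-along q) (+-cancelʳ-≤ _ _ _ (begin
    length (filterᵇ q xs) + length (filterᵇ (not ∘ q ∘ f) xs)       ≤⟨ +-monoʳ-≤ _ (≤-along (not ∘ q)) ⟩
    length (filterᵇ q xs) + length (filterᵇ (not ∘ q) xs)           ≡⟨ length-filterᵇ-not q xs ⟩
    length xs                                                       ≡⟨ sym (length-filterᵇ-not (q ∘ f) xs) ⟩
    length (filterᵇ (q ∘ f) xs) + length (filterᵇ (not ∘ q ∘ f) xs) ∎))
    where
      open ≤-Reasoning
      ≤-along : ∀ r → length (filterᵇ (r ∘ f) xs) ≤ length (filterᵇ r xs)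
      ≤-along r = leftInverse⇒length≤ f g (Unique-filterᵇ u) (Unique-filterᵇ u)
        (λ x∈ → let x∈xs , rfx = ∈-filterᵇ⁻ x∈ in ∈-filterᵇ⁺ (f∈ x∈xs) rfx)
        (g∘f≡id ∘ proj₁ ∘ ∈-filterᵇ⁻)

-- Permutations of [n]

∈-words⁻ : ∀ k (B : List ℕ) {w} → w ∈ words k B → length w ≡ k × w ⊆ B
∈-words⁻ zero    B (here refl) = refl , λ ()
∈-words⁻ (suc k) B w∈ with find (∈-concatMap⁻ (λ a → map (a ∷_) (words k B)) {xs = B} w∈)
... | a , a∈B , w∈′ with ∈-map⁻ (a ∷_) w∈′
... | v , v∈ , refl with ∈-words⁻ k B v∈
... | |v| , v⊆B = cong suc |v| , λ { (here refl) → a∈B ; (there z∈) → v⊆B z∈ }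

∈-words⁺ : ∀ k (B : List ℕ) {w} → length w ≡ k → w ⊆ B → w ∈ words k B
∈-words⁺ zero    B {[]}    _   _   = here refl
∈-words⁺ (suc k) B {a ∷ v} |w| w⊆B =
  ∈-concatMap⁺ (λ b → map (b ∷_) (words k B))
    (lose (w⊆B (here refl)) (∈-map⁺ (a ∷_) (∈-words⁺ k B (suc-injective |w|) (w⊆B ∘ there))))

Unique-words : ∀ k {B : List ℕ} → Unique B → Unique (words k B)
Unique-words zero        _  = [] ∷ []
Unique-words (suc k) {B} uB =
  Unique.concat⁺ (All.map⁺ (All.tabulate λ _ → Unique.map⁺ ∷-injectiveʳ (Unique-words k uB)))
                 (AllPairs.map⁺ (AllPairs.map disjoint uB))
  where
    disjoint : ∀ {a b} → a ≢ b → Disjoint (map (a ∷_) (words k B)) (map (b ∷_) (words k B))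
    disjoint a≢b (w∈a , w∈b) with _ , _ , refl ← ∈-map⁻ _ w∈a | _ , _ , eq ← ∈-map⁻ _ w∈b =
      a≢b (∷-injectiveˡ eq)

Unique-↭-∷-filter≢ : ∀ {a} {B : List ℕ} → Unique B → a ∈ B → B ↭ a ∷ filter (¬? ∘ (a ≟_)) B
Unique-↭-∷-filter≢ {a} {B} uB a∈B =
  Unique-⊆-⊇⇒↭ uB (a∉ ∷ Unique.filter⁺ (¬? ∘ (a ≟_)) uB) B⊆ ⊆B
  where
    a∉ : All (a ≢_) (filter (¬? ∘ (a ≟_)) B)
    a∉ = All.tabulate (proj₂ ∘ ∈-filter⁻ (¬? ∘ (a ≟_)) {xs = B})
    B⊆ : B ⊆ a ∷ filter (¬? ∘ (a ≟_)) B
    B⊆ {z} z∈ with a ≟ z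
    ... | yes refl = here refl
    ... | no  a≢z  = there (∈-filter⁺ (¬? ∘ (a ≟_)) z∈ a≢z)
    ⊆B : a ∷ filter (¬? ∘ (a ≟_)) B ⊆ B
    ⊆B (here refl) = a∈B
    ⊆B (there z∈)  = proj₁ (∈-filter⁻ (¬? ∘ (a ≟_)) z∈)

distinct-words-∷-↭ : ∀ k {a} {B : List ℕ} → Unique B →
  filterᵇ (distinct ∘ (a ∷_)) (words k B) ↭ filterᵇ distinct (words k (filter (¬? ∘ (a ≟_)) B))
distinct-words-∷-↭ k {a} {B} uB =
  Unique-⊆-⊇⇒↭ (Unique-filterᵇ (Unique-words k uB))
    (Unique-filterᵇ (Unique-words k (Unique.filter⁺ (¬? ∘ (a ≟_)) uB))) sub sup
  where
    B∖a : List ℕ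
    B∖a = filter (¬? ∘ (a ≟_)) B
    sub : filterᵇ (distinct ∘ (a ∷_)) (words k B) ⊆ filterᵇ distinct (words k B∖a)
    sub w∈ with w∈W , d ← ∈-filterᵇ⁻ w∈ with |w| , w⊆B ← ∈-words⁻ k B w∈W with a∉w ∷ uw ← distinct⁻ d =
      ∈-filterᵇ⁺ (∈-words⁺ k B∖a |w| (λ z∈ → ∈-filter⁺ (¬? ∘ (a ≟_)) (w⊆B z∈) (All.lookup a∉w z∈)))
                 (distinct⁺ uw)
    sup : filterᵇ distinct (words k B∖a) ⊆ filterᵇ (distinct ∘ (a ∷_)) (words k B)
    sup w∈ with w∈W , d ← ∈-filterᵇ⁻ w∈ with |w| , w⊆B∖a ← ∈-words⁻ k B∖a w∈W =
      ∈-filterᵇ⁺ (∈-words⁺ k B |w| (proj₁ ∘ ∈-filter⁻ (¬? ∘ (a ≟_)) ∘ w⊆B∖a))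
                 (distinct⁺ (All.tabulate (proj₂ ∘ ∈-filter⁻ (¬? ∘ (a ≟_)) {xs = B} ∘ w⊆B∖a) ∷ distinct⁻ d))

length-distinct-words : ∀ k {B : List ℕ} → Unique B → length B ≡ k →
  length (filterᵇ distinct (words k B)) ≡ k !
length-distinct-words zero        _  _   = refl
length-distinct-words (suc k) {B} uB |B| = begin
  length (filterᵇ distinct (words (suc k) B)) ≡⟨ length-filterᵇ-concatMap distinct _ B per-letter ⟩
  length B * k !                              ≡⟨ cong (_* k !) |B| ⟩
  suc k !                                     ∎
  where
    open ≡-Reasoning
    per-letter : ∀ {a} → a ∈ B → length (filterᵇ distinct (map (a ∷_) (words k B))) ≡ k !
    per-letter {a} a∈B = begin
      length (filterᵇ distinct (map (a ∷_) (words k B)))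
        ≡⟨ cong length (filterᵇ-map distinct (a ∷_) (words k B)) ⟩
      length (map (a ∷_) (filterᵇ (distinct ∘ (a ∷_)) (words k B)))
        ≡⟨ length-map (a ∷_) (filterᵇ (distinct ∘ (a ∷_)) (words k B)) ⟩
      length (filterᵇ (distinct ∘ (a ∷_)) (words k B))
        ≡⟨ ↭-length (distinct-words-∷-↭ k uB) ⟩
      length (filterᵇ distinct (words k (filter (¬? ∘ (a ≟_)) B)))
        ≡⟨ length-distinct-words k (Unique.filter⁺ _ uB) |B∖a| ⟩
      k ! ∎
      where
        |B∖a| : length (filter (¬? ∘ (a ≟_)) B) ≡ k
        |B∖a| = suc-injective (trans (sym (↭-length (Unique-↭-∷-filter≢ uB a∈B))) |B|)

∈-range⁺ : ∀ {n x} → 1 ≤ x → x ≤ n → x ∈ range n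
∈-range⁺ {x = suc i} _ i<n = ∈-map⁺ suc (∈-upTo⁺ i<n)

∈-range⁻ : ∀ {n x} → x ∈ range n → 1 ≤ x × x ≤ n
∈-range⁻ x∈ with _ , i∈ , refl ← ∈-map⁻ suc x∈ = s≤s z≤n , ∈-upTo⁻ i∈

Unique-range : ∀ n → Unique (range n)
Unique-range n = Unique.map⁺ suc-injective (Unique.upTo⁺ n)

AllPairs-<-range : ∀ n → AllPairs _<_ (range n)
AllPairs-<-range n = AllPairs.map⁺ (AllPairs.applyUpTo⁺₁ id n (λ i<j _ → s<s i<j))

length-range : ∀ n → length (range n) ≡ n
length-range n = trans (length-map suc (upTo n)) (length-upTo n)

Sym⁻ : ∀ n {π} → π ∈ Sym n → π ↭ range n
Sym⁻ n {π} π∈ with π∈W , d ← ∈-filterᵇ⁻ π∈ with |π| , π⊆ ← ∈-words⁻ n (range n) π∈W =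
  Unique-⊆-⊇⇒↭ uπ (Unique-range n) π⊆
    (Unique-⊆-length≥⇒⊇ _≟_ uπ (Unique-range n) π⊆ (≤-reflexive (trans (length-range n) (sym |π|))))
  where
    uπ : Unique π
    uπ = distinct⁻ d

Sym⁺ : ∀ n {π} → π ↭ range n → π ∈ Sym n
Sym⁺ n π↭ =
  ∈-filterᵇ⁺ (∈-words⁺ n (range n) (trans (↭-length π↭) (length-range n)) (∈-resp-↭ π↭))
             (distinct⁺ (Unique-resp-↭ (↭-sym π↭) (Unique-range n)))

Unique-Sym : ∀ n → Unique (Sym n)
Unique-Sym n = Unique-filterᵇ (Unique-words n (Unique-range n))

length-Sym : ∀ n → length (Sym n) ≡ n !
length-Sym n = length-distinct-words n (Unique-range n) (length-range n)

↭range⇒Unique : ∀ n {π} → π ↭ range n → Unique π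
↭range⇒Unique n π↭ = Unique-resp-↭ (↭-sym π↭) (Unique-range n)

↭range⇒length : ∀ n {π} → π ↭ range n → length π ≡ n
↭range⇒length n π↭ = trans (↭-length π↭) (length-range n)

at-applyUpTo : ∀ (g : ℕ → ℕ) {n i} → i < n → at (applyUpTo g n) (suc i) ≡ g i
at-applyUpTo g {suc n} {zero}  _         = refl
at-applyUpTo g {suc n} {suc i} (s≤s i<n) = at-applyUpTo (g ∘ suc) i<n

at-map-range : ∀ (f : ℕ → ℕ) {n x} → x ∈ range n → at (map f (range n)) x ≡ f x
at-map-range f {n} x∈ with _ , i∈ , refl ← ∈-map⁻ suc x∈ = begin
  at (map f (map suc (upTo n))) _ ≡⟨ cong (λ l → at l _) (trans (sym (map-∘ (upTo n))) (map-applyUpTo id (f ∘ suc) n)) ⟩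
  at (applyUpTo (f ∘ suc) n) _    ≡⟨ at-applyUpTo (f ∘ suc) (∈-upTo⁻ i∈) ⟩
  f _                             ∎
  where open ≡-Reasoning

∈⇒at : ∀ {v : ℕ} {xs} → v ∈ xs → ∃ λ i → i < length xs × at xs (suc i) ≡ v
∈⇒at (here refl) = zero , s≤s z≤n , refl
∈⇒at {xs = _ ∷ _ ∷ _} (there v∈) with i , i< , at≡ ← ∈⇒at v∈ = suc i , s≤s i< , at≡

at-∈ : ∀ (xs : List ℕ) {i} → i < length xs → at xs (suc i) ∈ xs
at-∈ (x ∷ xs) {zero}  _         = here refl
at-∈ (x ∷ xs) {suc i} (s≤s i<n) = there (at-∈ xs i<n)

at≢head : ∀ {x : ℕ} {xs i} → Unique (x ∷ xs) → 2 ≤ i → i ≤ length (x ∷ xs) → at (x ∷ xs) i ≢ x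
at≢head {xs = xs} {suc (suc i)} (x∉ ∷ _) _ (s≤s i<) at≡x = All¬⇒¬Any x∉ (subst (_∈ xs) at≡x (at-∈ xs i<))
at≢head {i = suc zero} _ (s≤s ()) _ _

-- Blocks and the inverse of θ

blocksFrom : ℕ → List ℕ → List ℕ → List (List ℕ)
blocksFrom h acc []       = (h ∷ acc) ∷ []
blocksFrom h acc (x ∷ xs) = if h <ᵇ x then (h ∷ acc) ∷ blocksFrom x [] xs else blocksFrom h (acc ++ [ x ]) xs

blocks : List ℕ → List (List ℕ)
blocks []       = []
blocks (x ∷ xs) = blocksFrom x [] xs

-- The standard cycle form of the paper, with all cycle maxima above m.
data StandardForm : ℕ → List (List ℕ) → Set where
  []    : ∀ {m} → StandardForm m []
  block : ∀ {m h t bs} → m < h → All (_< h) t → StandardForm h bs → StandardForm m ((h ∷ t) ∷ bs)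

concat∘blocksFrom : ∀ h acc xs → concat (blocksFrom h acc xs) ≡ h ∷ acc ++ xs
concat∘blocksFrom h acc []       = refl
concat∘blocksFrom h acc (x ∷ xs) with h <ᵇ x
... | true  = cong (λ ys → h ∷ acc ++ ys) (concat∘blocksFrom x [] xs)
... | false = trans (concat∘blocksFrom h (acc ++ [ x ]) xs) (cong (h ∷_) (++-assoc acc [ x ] xs))

concat∘blocks : ∀ π → concat (blocks π) ≡ π
concat∘blocks []       = refl
concat∘blocks (x ∷ xs) = concat∘blocksFrom x [] xs

blocks-∷ : ∀ x xs → ∃₂ λ c cs → blocks (x ∷ xs) ≡ c ∷ cs
blocks-∷ x xs with blocks (x ∷ xs) | concat∘blocks (x ∷ xs)
... | c ∷ cs | _ = c , cs , refl

standard-blocksFrom : ∀ {m h acc xs} → m < h → All (_< h) acc → Unique (h ∷ xs) → StandardForm m (blocksFrom h acc xs)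
standard-blocksFrom {xs = []}                m<h acc<h _                           = block m<h acc<h []
standard-blocksFrom {h = h} {xs = x ∷ xs} m<h acc<h ((h≢x ∷ h∉xs) ∷ x∷xs!) with h <ᵇ x | <ᵇ-reflects-< h x
... | true  | ofʸ h<x = block m<h acc<h (standard-blocksFrom h<x [] x∷xs!)
... | false | ofⁿ h≮x = standard-blocksFrom m<h (All.++⁺ acc<h (x<h ∷ [])) (h∉xs ∷ AllPairs.tail x∷xs!)
  where
    x<h : x < h
    x<h = ≤∧≢⇒< (≮⇒≥ h≮x) (h≢x ∘ sym)

standard-blocks : ∀ {m π} → Unique π → All (m <_) π → StandardForm m (blocks π)
standard-blocks {π = []}    _  _         = []
standard-blocks {π = _ ∷ _} uπ (m<x ∷ _) = standard-blocksFrom m<x [] uπ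

blocksFrom-concat : ∀ {h} acc t {cs} → All (_< h) t → StandardForm h cs →
  blocksFrom h acc (t ++ concat cs) ≡ (h ∷ acc ++ t) ∷ cs
blocksFrom-concat {h} acc (y ∷ t) (y<h ∷ t<h) std with h <ᵇ y | <ᵇ-reflects-< h y
... | true  | ofʸ h<y = contradiction y<h (<-asym h<y)
... | false | ofⁿ _   =
  trans (blocksFrom-concat (acc ++ [ y ]) t t<h std) (cong (λ zs → (h ∷ zs) ∷ _) (++-assoc acc [ y ] t))
blocksFrom-concat     acc [] [] []  = cong (λ zs → (_ ∷ zs) ∷ []) (sym (++-identityʳ acc))
blocksFrom-concat {h} acc [] [] (block {h = h′} {t = t′} h<h′ t′<h′ std) with h <ᵇ h′ | <ᵇ-reflects-< h h′
... | true  | ofʸ _    =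
  cong₂ (λ zs bs → (h ∷ zs) ∷ bs) (sym (++-identityʳ acc)) (blocksFrom-concat [] t′ t′<h′ std)
... | false | ofⁿ h≮h′ = contradiction h<h′ h≮h′

blocks∘concat : ∀ {m bs} → StandardForm m bs → blocks (concat bs) ≡ bs
blocks∘concat []                        = refl
blocks∘concat (block {t = t} _ t<h std) = blocksFrom-concat [] t t<h std

standard-++ˡ : ∀ {m} bs {cs} → StandardForm m (bs ++ cs) → StandardForm m bs
standard-++ˡ []             _                   = []
standard-++ˡ ((_ ∷ _) ∷ bs) (block m<h t<h std) = block m<h t<h (standard-++ˡ bs std)

standard-block : ∀ {m bs h t} → StandardForm m bs → (h ∷ t) ∈ bs → All (_< h) t
standard-block (block _ t<h _) (here refl) = t<h
standard-block (block _ _ std) (there b∈)  = standard-block std b∈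

standard-gather : ∀ {m} bs {v cs} → StandardForm m (bs ++ [ v ] ∷ cs) → StandardForm m ((v ∷ concat bs) ∷ cs)
standard-gather []             std                 = std
standard-gather ((h ∷ t) ∷ bs) (block m<h t<h std) with standard-gather bs std
... | block h<v rest<v std′ =
  block (<-trans m<h h<v) (h<v ∷ All.++⁺ (All.map (λ y<h → <-trans y<h h<v) t<h) rest<v) std′

standard-scatter : ∀ {m bs v cs} → StandardForm m bs → StandardForm m ((v ∷ concat bs) ∷ cs) →
  StandardForm m (bs ++ [ v ] ∷ cs)
standard-scatter []                          std                                 = std
standard-scatter (block {t = t} m<h t<h std) (block m<v (h<v ∷ rest<v) std′) =
  block m<h t<h (standard-scatter std (block h<v (All.++⁻ʳ t rest<v) std′))

heads : List (List ℕ) → List ℕ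
heads []             = []
heads ([] ∷ bs)      = heads bs
heads ((h ∷ _) ∷ bs) = h ∷ heads bs

∈-heads⁻ : ∀ {bs h} → h ∈ heads bs → ∃ λ t → (h ∷ t) ∈ bs
∈-heads⁻ {[] ∷ bs}      h∈          = Product.map₂ there (∈-heads⁻ h∈)
∈-heads⁻ {(_ ∷ t) ∷ bs} (here refl) = t , here refl
∈-heads⁻ {(_ ∷ _) ∷ bs} (there h∈)  = Product.map₂ there (∈-heads⁻ h∈)

∈-heads⁺ : ∀ {bs h t} → (h ∷ t) ∈ bs → h ∈ heads bs
∈-heads⁺ {(_ ∷ _) ∷ bs} (here refl) = here refl
∈-heads⁺ {[] ∷ bs}      (there b∈)  = ∈-heads⁺ b∈
∈-heads⁺ {(_ ∷ _) ∷ bs} (there b∈)  = there (∈-heads⁺ b∈)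

standard-heads : ∀ {m bs} → StandardForm m bs → All (m <_) (heads bs) × AllPairs _<_ (heads bs)
standard-heads []                                    = [] , []
standard-heads (block m<h _ std) with h< , sorted ← standard-heads std = m<h ∷ All.map (<-trans m<h) h< , h< ∷ sorted

map-heads : ∀ {m bs} (g : ℕ → List ℕ) → StandardForm m bs → (∀ {h t} → (h ∷ t) ∈ bs → g h ≡ h ∷ t) →
  map g (heads bs) ≡ bs
map-heads g []              _  = refl
map-heads g (block _ _ std) g≡ = cong₂ _∷_ (g≡ (here refl)) (map-heads g std (g≡ ∘ there))

↭range⇒standard : ∀ n {π} → π ↭ range n → StandardForm 0 (blocks π)
↭range⇒standard n π↭ =
  standard-blocks (↭range⇒Unique n π↭) (All.tabulate (proj₁ ∘ ∈-range⁻ ∘ ∈-resp-↭ π↭))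

↭range⇒blocks≢[] : ∀ n {π} → 1 ≤ n → π ↭ range n → blocks π ≢ []
↭range⇒blocks≢[] n {π} 1≤n π↭ eq = <⇒≢ 1≤n (sym (begin
  n        ≡⟨ sym (↭range⇒length n π↭) ⟩
  length π ≡⟨ cong length (trans (sym (concat∘blocks π)) (cong concat eq)) ⟩
  0        ∎))
  where open ≡-Reasoning

Walk : (ℕ → ℕ) → ℕ → List ℕ → ℕ → Set
Walk f x []       e = f x ≡ e
Walk f x (y ∷ ys) e = f x ≡ y × Walk f y ys e

module _ {f : ℕ → ℕ} where

  walk-++⁻ : ∀ {x y zs e} ys → Walk f x (ys ++ y ∷ zs) e → Walk f x ys y × Walk f y zs e
  walk-++⁻ []       (fx≡y , w) = fx≡y , w
  walk-++⁻ (_ ∷ ys) (fx≡ , w)  = Product.map₁ (fx≡ ,_) (walk-++⁻ ys w)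

  walk-++⁺ : ∀ {x y zs e} ys → Walk f x ys y → Walk f y zs e → Walk f x (ys ++ y ∷ zs) e
  walk-++⁺ []       fx≡y       w = fx≡y , w
  walk-++⁺ (_ ∷ ys) (fx≡ , w′) w = fx≡ , walk-++⁺ ys w′ w

  walk-map : ∀ {x e} ys → Walk f x ys e → map f (x ∷ ys) ≡ ys ++ [ e ]
  walk-map []       fx≡e       = cong [_] fx≡e
  walk-map (_ ∷ ys) (fx≡y , w) = cong₂ _∷_ fx≡y (walk-map ys w)

  walk-rotation : ∀ {h t x} → Walk f h t h → x ∈ h ∷ t → ∃ λ ys → Walk f x ys x × x ∷ ys ↭ h ∷ t
  walk-rotation {t = t} w (here refl) = t , w , ↭-refl
  walk-rotation {h} w (there x∈t) with t₁ , t₂ , refl ← ∈-∃++ x∈t with w₁ , w₂ ← walk-++⁻ t₁ w =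
    t₂ ++ h ∷ t₁ , walk-++⁺ t₂ w₂ w₁ , ++-comm (_ ∷ t₂) (h ∷ t₁)

  map-concat-↭ : ∀ bs → (∀ {h t} → (h ∷ t) ∈ bs → Walk f h t h) → map f (concat bs) ↭ concat bs
  map-concat-↭ []             _ = ↭-refl
  map-concat-↭ ([] ∷ bs)      w = map-concat-↭ bs (w ∘ there)
  map-concat-↭ ((h ∷ t) ∷ bs) w = begin
    map f ((h ∷ t) ++ concat bs)       ≡⟨ map-++ f (h ∷ t) (concat bs) ⟩
    map f (h ∷ t) ++ map f (concat bs) ≡⟨ cong (_++ _) (walk-map t (w (here refl))) ⟩
    (t ++ [ h ]) ++ map f (concat bs)  ↭⟨ ++-↭ (↭-sym (∷↭∷ʳ h t)) (map-concat-↭ bs (w ∘ there)) ⟩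
    (h ∷ t) ++ concat bs               ∎
    where open PermutationReasoning

walk-cong : ∀ {f g x e} ys → (∀ {w} → w ∈ x ∷ ys → f w ≡ g w) → Walk f x ys e → Walk g x ys e
walk-cong []       f≗g fx≡e       = trans (sym (f≗g (here refl))) fx≡e
walk-cong (_ ∷ ys) f≗g (fx≡y , w) = trans (sym (f≗g (here refl))) fx≡y , walk-cong ys (f≗g ∘ there) w

walk-iter : ∀ σ {x e} ys → Walk (at σ) x ys e → ∀ k → iter σ (length ys + suc k) x ≡ ys ++ e ∷ iter σ k e
walk-iter σ []       refl       k = refl
walk-iter σ (y ∷ ys) (refl , w) k = cong (y ∷_) (walk-iter σ ys w k)

cycleFrom-walk : ∀ {n σ x} ys → Walk (at σ) x ys x → x ∉ ys → length ys < n → cycleFrom n σ x ≡ x ∷ ys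
cycleFrom-walk {n} {σ} {x} ys w x∉ys |ys|<n = cong (x ∷_) (begin
  takeWhileᵇ (λ y → not (y ≡ᵇ x)) (iter σ n x)                   ≡⟨ cong (λ k → takeWhileᵇ _ (iter σ k x)) n≡ ⟩
  takeWhileᵇ (λ y → not (y ≡ᵇ x)) (iter σ (length ys + suc k) x) ≡⟨ cong (takeWhileᵇ _) (walk-iter σ ys w k) ⟩
  takeWhileᵇ (λ y → not (y ≡ᵇ x)) (ys ++ x ∷ iter σ k x)         ≡⟨ takeWhileᵇ-++ _ ys ys≢x x≢x-false ⟩
  ys                                                             ∎)
  where
    open ≡-Reasoning
    k : ℕ
    k = n ∸ suc (length ys)
    n≡ : n ≡ length ys + suc k
    n≡ = sym (trans (+-suc (length ys) k) (m+[n∸m]≡n |ys|<n))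
    ys≢x : All (T ∘ λ y → not (y ≡ᵇ x)) ys
    ys≢x = All.tabulate λ {y} y∈ → Equivalence.from T-not λ y≡x → x∉ys (subst (_∈ ys) (≡ᵇ⇒≡ y x y≡x) y∈)
    x≢x-false : ¬ T (not (x ≡ᵇ x))
    x≢x-false x≢x = Equivalence.to T-not x≢x (≡⇒≡ᵇ x x refl)

successorIn : ℕ → List ℕ → ℕ → ℕ
successorIn h []           x = h
successorIn h (y ∷ [])     x = h
successorIn h (y ∷ z ∷ ys) x = if x ≡ᵇ y then z else successorIn h (z ∷ ys) x

successor : List (List ℕ) → ℕ → ℕ
successor []             x = x
successor ([] ∷ bs)      x = successor bs x
successor ((h ∷ t) ∷ bs) x = if elem x (h ∷ t) then successorIn h (h ∷ t) x else successor bs x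

walk-successorIn : ∀ h {y} ys → Unique (y ∷ ys) → Walk (successorIn h (y ∷ ys)) y ys h
walk-successorIn h     []       _        = refl
walk-successorIn h {y} (z ∷ zs) (y∉ ∷ u) rewrite ≡ᵇ-refl y = refl , walk-cong zs agree (walk-successorIn h zs u)
  where
    agree : ∀ {w} → w ∈ z ∷ zs → successorIn h (z ∷ zs) w ≡ successorIn h (y ∷ z ∷ zs) w
    agree {w} w∈ rewrite ≢⇒≡ᵇ≡false {w} {y} (λ { refl → All¬⇒¬Any y∉ w∈ }) = refl

successor-block : ∀ bs {h t x} → Unique (concat bs) → (h ∷ t) ∈ bs → x ∈ h ∷ t →
  successor bs x ≡ successorIn h (h ∷ t) x
successor-block (_ ∷ _)          _ (here refl) x∈ rewrite ∈⇒elem≡true x∈ = refl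
successor-block ([] ∷ bs)        u (there b∈)  x∈ = successor-block bs u b∈ x∈
successor-block ((h′ ∷ t′) ∷ bs) u (there b∈)  x∈ with _ , ubs , disjoint ← Unique-++⁻ (h′ ∷ t′) u
  rewrite ∉⇒elem≡false (λ x∈′ → disjoint (x∈′ , ∈-concat⁺′ x∈ b∈)) = successor-block bs ubs b∈ x∈

walk-successor : ∀ {bs h t} → Unique (concat bs) → (h ∷ t) ∈ bs → Walk (successor bs) h t h
walk-successor {bs} {h} {t} u b∈ =
  walk-cong t (λ w∈ → sym (successor-block bs u b∈ w∈)) (walk-successorIn h t (Unique-concat-∈ u b∈))

-- π̂ = θ⁻¹(π) in one-line notation: the blocks of π are its cycles.
hat : ℕ → List ℕ → List ℕ
hat n π = map (successor (blocks π)) (range n)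

module _ (n : ℕ) {π} (π↭ : π ↭ range n) where
  private
    bs : List (List ℕ)
    bs = blocks π

    σ : List ℕ
    σ = hat n π

    u-concat : Unique (concat bs)
    u-concat = subst Unique (sym (concat∘blocks π)) (↭range⇒Unique n π↭)

    std : StandardForm 0 bs
    std = ↭range⇒standard n π↭

    in-range : ∀ {b x} → b ∈ bs → x ∈ b → x ∈ range n
    in-range b∈ x∈ = ∈-resp-↭ π↭ (subst (_ ∈_) (concat∘blocks π) (∈-concat⁺′ x∈ b∈))

    block-of : ∀ {x} → x ∈ range n → ∃₂ λ h t → (h ∷ t) ∈ bs × x ∈ h ∷ t
    block-of x∈ with ∈-concat⁻′ bs (subst (_ ∈_) (sym (concat∘blocks π)) (∈-resp-↭ (↭-sym π↭) x∈))
    ... | _ ∷ _ , x∈b , b∈ = _ , _ , b∈ , x∈b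

    walk-σ : ∀ {h t} → (h ∷ t) ∈ bs → Walk (at σ) h t h
    walk-σ b∈ = walk-cong _ (λ w∈ → sym (at-map-range (successor bs) (in-range b∈ w∈))) (walk-successor u-concat b∈)

    cycle-of : ∀ {x h t} → (h ∷ t) ∈ bs → x ∈ h ∷ t →
      ∃ λ ys → Walk (at σ) x ys x × x ∷ ys ↭ h ∷ t × Unique (x ∷ ys) × cycleFrom n σ x ≡ x ∷ ys
    cycle-of {x} {h} {t} b∈ x∈ with ys , w , x∷ys↭ ← walk-rotation (walk-σ b∈) x∈ =
      ys , w , x∷ys↭ , u ,
      cycleFrom-walk ys w (Unique.Unique[x∷xs]⇒x∉xs u) (subst (_≤ n) (sym (↭-length x∷ys↭)) |b|≤n)
      where
        u : Unique (x ∷ ys)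
        u = Unique-resp-↭ (↭-sym x∷ys↭) (Unique-concat-∈ u-concat b∈)
        |b|≤n : length (h ∷ t) ≤ n
        |b|≤n = subst (_ ≤_) (length-range n)
          (Unique-⊆⇒length≤ _≟_ (Unique-concat-∈ u-concat b∈) (Unique-range n) (in-range b∈))

    cycleFrom-head : ∀ {h t} → (h ∷ t) ∈ bs → cycleFrom n σ h ≡ h ∷ t
    cycleFrom-head b∈ = proj₂ (proj₂ (proj₂ (proj₂ (cycle-of b∈ (here refl)))))

    maxima⊆heads : filterᵇ (isCycleMax n σ) (range n) ⊆ heads bs
    maxima⊆heads {x} x∈ with x∈range , isMax ← ∈-filterᵇ⁻ x∈ with h , _ , b∈ , x∈b ← block-of x∈range | x∈b
    ... | here refl = ∈-heads⁺ b∈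
    ... | there x∈t with _ , _ , x∷ys↭ , _ , cyc ← cycle-of b∈ (there x∈t) =
      contradiction (All.lookup (standard-block std b∈) x∈t) (≤⇒≯ (≤ᵇ⇒≤ h x h≤ᵇx))
      where
        h≤ᵇx : T (h ≤ᵇ x)
        h≤ᵇx = All.lookup (allᵇ⁻ (subst (T ∘ allᵇ _) cyc isMax)) (∈-resp-↭ (↭-sym x∷ys↭) (here refl))

    heads⊆maxima : heads bs ⊆ filterᵇ (isCycleMax n σ) (range n)
    heads⊆maxima {h} h∈ with t , b∈ ← ∈-heads⁻ h∈ =
      ∈-filterᵇ⁺ (in-range b∈ (here refl)) (subst (T ∘ allᵇ (_≤ᵇ h)) (sym (cycleFrom-head b∈))
        (allᵇ⁺ {xs = h ∷ t} (≤⇒≤ᵇ (≤-refl {h}) ∷ All.map (≤⇒≤ᵇ ∘ <⇒≤) (standard-block std b∈))))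

    maxima≡heads : filterᵇ (isCycleMax n σ) (range n) ≡ heads bs
    maxima≡heads = strictlySorted-≡ maxima-sorted (proj₂ (standard-heads std)) maxima⊆heads heads⊆maxima
      where
        maxima-sorted : AllPairs _<_ (filterᵇ (isCycleMax n σ) (range n))
        maxima-sorted = subst (AllPairs _<_) (sym (filterᵇ≗filter _ (range n)))
                              (AllPairs.filter⁺ (T? ∘ isCycleMax n σ) (AllPairs-<-range n))

  hat-↭ : hat n π ↭ range n
  hat-↭ = begin
    map (successor bs) (range n)   ↭⟨ map-↭ (successor bs) (↭-sym π↭) ⟩
    map (successor bs) π           ≡⟨ cong (map (successor bs)) (sym (concat∘blocks π)) ⟩
    map (successor bs) (concat bs) ↭⟨ map-concat-↭ bs (walk-successor u-concat) ⟩
    concat bs                      ≡⟨ concat∘blocks π ⟩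
    π                              ↭⟨ π↭ ⟩
    range n                        ∎
    where open PermutationReasoning

  θ∘hat : θ n (hat n π) ≡ π
  θ∘hat = begin
    concat (map id (map (cycleFrom n σ) maxima)) ≡⟨ cong concat (map-id (map (cycleFrom n σ) maxima)) ⟩
    concat (map (cycleFrom n σ) maxima)          ≡⟨ cong (concat ∘ map _) maxima≡heads ⟩
    concat (map (cycleFrom n σ) (heads bs))      ≡⟨ cong concat (map-heads _ std cycleFrom-head) ⟩
    concat bs                                    ≡⟨ concat∘blocks π ⟩
    π                                            ∎
    where
      open ≡-Reasoning
      maxima : List ℕ
      maxima = filterᵇ (isCycleMax n σ) (range n)

  hat-fixedPoint : ∀ {x} → x ∈ range n → at (hat n π) x ≡ x ⇔ [ x ] ∈ blocks π
  hat-fixedPoint x∈ = mk⇔ fixed⇒singleton walk-σ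
    where
      fixed⇒singleton : at σ _ ≡ _ → [ _ ] ∈ bs
      fixed⇒singleton σx≡x with _ , _ , b∈ , x∈b ← block-of x∈ with cycle-of b∈ x∈b
      ... | [] , _ , x∷[]↭h∷t , _ with refl ← ↭-singleton-inv (↭-sym x∷[]↭h∷t) = b∈
      ... | _ ∷ _ , (σx≡y , _) , _ , (x≢y ∷ _) ∷ _ , _ = contradiction (trans (sym σx≡x) σx≡y) x≢y

hat-surjective : ∀ n {σ} → σ ∈ Sym n → ∃ λ π → π ∈ Sym n × hat n π ≡ σ
hat-surjective n σ∈ = let π , π∈ , σ≡ = ∈-map⁻ (hat n) (Sym⊆image σ∈) in π , π∈ , sym σ≡
  where
    image⊆Sym : map (hat n) (Sym n) ⊆ Sym n
    image⊆Sym σ′∈ with π , π∈ , refl ← ∈-map⁻ (hat n) σ′∈ = Sym⁺ n (hat-↭ n (Sym⁻ n π∈))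
    Sym⊆image : Sym n ⊆ map (hat n) (Sym n)
    Sym⊆image = Unique-⊆-length≥⇒⊇ (≡-dec _≟_)
      (Unique-map-leftInverse (hat n) (θ n) (Unique-Sym n) (λ π∈ → θ∘hat n (Sym⁻ n π∈)))
      (Unique-Sym n) image⊆Sym (≤-reflexive (sym (length-map (hat n) (Sym n))))

θ⁻¹-unique : ∀ n {σ π} → σ ∈ Sym n → θ n σ ≡ π → σ ≡ hat n π
θ⁻¹-unique n {σ} {π} σ∈ θσ≡π = begin
  σ                      ≡⟨ sym hatπ′≡σ ⟩
  hat n π′               ≡⟨ sym (cong (hat n) (θ∘hat n (Sym⁻ n π′∈))) ⟩
  hat n (θ n (hat n π′)) ≡⟨ cong (hat n ∘ θ n) hatπ′≡σ ⟩
  hat n (θ n σ)          ≡⟨ cong (hat n) θσ≡π ⟩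
  hat n π                ∎
  where
    open ≡-Reasoning
    π′ : List ℕ
    π′ = proj₁ (hat-surjective n σ∈)
    π′∈ : π′ ∈ Sym n
    π′∈ = proj₁ (proj₂ (hat-surjective n σ∈))
    hatπ′≡σ : hat n π′ ≡ σ
    hatπ′≡σ = proj₂ (proj₂ (hat-surjective n σ∈))

-- Occurrences of (12; 2→2)

isSingleton : List ℕ → Bool
isSingleton (_ ∷ []) = true
isSingleton _        = false

hasSingleton : List (List ℕ) → Bool
hasSingleton = anyᵇ isSingleton

lateSingleton : List ℕ → Bool
lateSingleton π = hasSingleton (drop 1 (blocks π))

singletonFree : List ℕ → Bool
singletonFree π = not (hasSingleton (blocks π))

hasSingleton⁺ : ∀ {v bs} → [ v ] ∈ bs → T (hasSingleton bs)
hasSingleton⁺ v∈ = anyᵇ⁺ (lose v∈ _)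

hasSingleton⁻ : ∀ {bs} → T (hasSingleton bs) → ∃ λ v → [ v ] ∈ bs
hasSingleton⁻ {bs} h with find (anyᵇ⁻ {p = isSingleton} {xs = bs} h)
... | _ ∷ [] , b∈ , _ = _ , b∈

lastSingleton : ∀ bs → T (hasSingleton bs) →
  ∃ λ pre → ∃₂ λ v post → bs ≡ pre ++ [ v ] ∷ post × T (not (hasSingleton post))
lastSingleton (b ∷ bs) h with T? (hasSingleton bs)
... | yes in-bs with pre , v , post , refl , free ← lastSingleton bs in-bs = b ∷ pre , v , post , refl , free
lastSingleton ((v ∷ []) ∷ bs)    _ | no ¬in-bs = [] , v , bs , refl , Equivalence.from T-not ¬in-bs
lastSingleton ([] ∷ bs)          h | no ¬in-bs = contradiction h ¬in-bs
lastSingleton ((_ ∷ _ ∷ _) ∷ bs) h | no ¬in-bs = contradiction h ¬in-bs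

lateSingleton-blocks : ∀ {bs} → StandardForm 0 bs → T (hasSingleton (drop 1 bs)) →
  ∃₂ λ h t → ∃ λ pre → ∃₂ λ v post → bs ≡ (h ∷ t) ∷ pre ++ [ v ] ∷ post × T (not (hasSingleton post))
lateSingleton-blocks (block {h = h} {t} {bs} _ _ _) late with pre , v , post , refl , free ← lastSingleton bs late =
  h , t , pre , v , post , refl , free

singletonFree-blocks : ∀ {bs} → StandardForm 0 bs → bs ≢ [] → T (not (hasSingleton bs)) →
  ∃₂ λ v r → ∃₂ λ rs bs′ → bs ≡ (v ∷ r ∷ rs) ∷ bs′ × T (not (hasSingleton bs′))
singletonFree-blocks []                                bs≢[] _    = contradiction refl bs≢[]
singletonFree-blocks (block {h = v} {r ∷ rs} {bs′} _ _ _) _     free = v , r , rs , bs′ , refl , free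

∈-subsetsOf-2⁻ : ∀ n X → X ∈ subsetsOf 2 n →
  ∃₂ λ a b → X ≡ a ∷ b ∷ [] × a < b × a ∈ range n × b ∈ range n
∈-subsetsOf-2⁻ n X X∈ with ∈-filterᵇ⁻ X∈
... | X∈W , _ with ∈-words⁻ 2 (range n) X∈W
∈-subsetsOf-2⁻ _ (a ∷ b ∷ []) _ | _ , a<b | _ , X⊆ =
  a , b , refl , <ᵇ⇒< a b (proj₁ (Equivalence.to T-∧ a<b)) , X⊆ (here refl) , X⊆ (there (here refl))

∈-subsetsOf-2⁺ : ∀ n {a b} → a < b → a ∈ range n → b ∈ range n → (a ∷ b ∷ []) ∈ subsetsOf 2 n
∈-subsetsOf-2⁺ n a<b a∈ b∈ =
  ∈-filterᵇ⁺ (∈-words⁺ 2 (range n) refl λ { (here refl) → a∈ ; (there (here refl)) → b∈ ; (there (there ())) })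
             (Equivalence.from T-∧ (<⇒<ᵇ a<b , _))

andᵇ-zipWith-≡ᵇ⁻ : ∀ (xs ys : List ℕ) → T (andᵇ (zipWith _≡ᵇ_ xs ys)) → length xs ≡ length ys → xs ≡ ys
andᵇ-zipWith-≡ᵇ⁻ []       []       _ _     = refl
andᵇ-zipWith-≡ᵇ⁻ (x ∷ xs) (y ∷ ys) h |xs|≡ with x≡y , rest ← Equivalence.to T-∧ h =
  cong₂ _∷_ (≡ᵇ⇒≡ x y x≡y) (andᵇ-zipWith-≡ᵇ⁻ xs ys rest (suc-injective |xs|≡))

andᵇ-zipWith-≡ᵇ⁺ : ∀ (xs : List ℕ) → T (andᵇ (zipWith _≡ᵇ_ xs xs))
andᵇ-zipWith-≡ᵇ⁺ []       = _
andᵇ-zipWith-≡ᵇ⁺ (x ∷ xs) = Equivalence.from T-∧ (≡⇒≡ᵇ x x refl , andᵇ-zipWith-≡ᵇ⁺ xs)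

isHat⁻ : ∀ n π σ → T (isHat n π σ) → θ n σ ≡ π
isHat⁻ n π σ h with eq , |eq| ← Equivalence.to T-∧ h = andᵇ-zipWith-≡ᵇ⁻ (θ n σ) π eq (≡ᵇ⇒≡ _ _ |eq|)

isHat⁺ : ∀ n π σ → θ n σ ≡ π → T (isHat n π σ)
isHat⁺ n _ σ refl = Equivalence.from T-∧ (andᵇ-zipWith-≡ᵇ⁺ (θ n σ) , ≡⇒≡ᵇ (length (θ n σ)) _ refl)

-- containsᵇ with its witness σ replaced by π̂, which θ⁻¹-unique shows to be the only candidate
record Occurrence (n : ℕ) (π : List ℕ) : Set where
  field
    x₁ x₂ t₁ t₂ : ℕ
    x₁<x₂       : x₁ < x₂
    t₁<t₂       : t₁ < t₂
    x₁∈         : x₁ ∈ range n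
    x₂∈         : x₂ ∈ range n
    t₁∈         : t₁ ∈ range n
    t₂∈         : t₂ ∈ range n
    π[t₁]≡x₁    : at π t₁ ≡ x₁
    π[t₂]≡x₂    : at π t₂ ≡ x₂
    x₂-fixed    : at (hat n π) x₂ ≡ x₂

containsᵇ⇒occurrence : ∀ n {π} → π ∈ Sym n → T (containsᵇ n p12-2→2 π) → Occurrence n π
containsᵇ⇒occurrence n {π} π∈ h
  with σ , σ∈ , hσ ← find (anyᵇ⁻ {xs = Sym n} h)
  with isHat-σ , hX ← Equivalence.to (T-∧ {isHat n π σ}) hσ
  with X , X∈ , hX′ ← find (anyᵇ⁻ {xs = subsetsOf 2 n} hX)
  with x₁ , x₂ , refl , x₁<x₂ , x₁∈ , x₂∈ ← ∈-subsetsOf-2⁻ n X X∈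
  with hT , hfix ← Equivalence.to T-∧ hX′
  with T′ , T∈ , hpos ← find (anyᵇ⁻ {xs = subsetsOf 2 n} hT)
  with t₁ , t₂ , refl , t₁<t₂ , t₁∈ , t₂∈ ← ∈-subsetsOf-2⁻ n T′ T∈
  with π[t₁] , π[t₂] ← Equivalence.to (T-∧ {at π t₁ ≡ᵇ x₁}) hpos = record
  { x₁<x₂    = x₁<x₂
  ; t₁<t₂    = t₁<t₂
  ; x₁∈      = x₁∈
  ; x₂∈      = x₂∈
  ; t₁∈      = t₁∈
  ; t₂∈      = t₂∈
  ; π[t₁]≡x₁ = ≡ᵇ⇒≡ _ _ π[t₁]
  ; π[t₂]≡x₂ = ≡ᵇ⇒≡ _ _ (proj₁ (Equivalence.to T-∧ π[t₂]))
  ; x₂-fixed = subst (λ τ → at τ x₂ ≡ x₂) (θ⁻¹-unique n σ∈ (isHat⁻ n π σ isHat-σ))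
                     (≡ᵇ⇒≡ _ _ (proj₁ (Equivalence.to T-∧ hfix)))
  }

occurrence⇒containsᵇ : ∀ n {π} → π ∈ Sym n → Occurrence n π → T (containsᵇ n p12-2→2 π)
occurrence⇒containsᵇ n {π} π∈ o =
  anyᵇ⁺ (lose (Sym⁺ n (hat-↭ n π↭)) (Equivalence.from T-∧ (isHat⁺ n π (hat n π) (θ∘hat n π↭) ,
    anyᵇ⁺ (lose (∈-subsetsOf-2⁺ n x₁<x₂ x₁∈ x₂∈) (Equivalence.from T-∧ (
      anyᵇ⁺ (lose (∈-subsetsOf-2⁺ n t₁<t₂ t₁∈ t₂∈) (Equivalence.from T-∧
        (≡⇒≡ᵇ _ _ π[t₁]≡x₁ , Equivalence.from T-∧ (≡⇒≡ᵇ _ _ π[t₂]≡x₂ , _)))) ,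
      Equivalence.from T-∧ (≡⇒≡ᵇ _ _ x₂-fixed , _)))))))
  where
    open Occurrence o
    π↭ : π ↭ range n
    π↭ = Sym⁻ n π∈

-- A fixed point that is the first block would sit at position 1, but t₂ ≥ 2.
occurrence⇒lateSingleton : ∀ n {π} → π ↭ range n → Occurrence n π → T (lateSingleton π)
occurrence⇒lateSingleton n {π} π↭ o = late (Equivalence.to (hat-fixedPoint n π↭ x₂∈) x₂-fixed) (concat∘blocks π)
  where
    open Occurrence o
    late : ∀ {bs} → [ x₂ ] ∈ bs → concat bs ≡ π → T (hasSingleton (drop 1 bs))
    late (there x₂∈)             _  = hasSingleton⁺ x₂∈
    late {_ ∷ bs} (here refl) π≡ =
      contradiction π[t₂]≡x₂ (subst (λ τ → at τ t₂ ≢ x₂) π≡ (at≢head u 2≤t₂ t₂≤))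
      where
        u : Unique (x₂ ∷ concat bs)
        u = subst Unique (sym π≡) (↭range⇒Unique n π↭)
        2≤t₂ : 2 ≤ t₂
        2≤t₂ = ≤-trans (s≤s (proj₁ (∈-range⁻ t₁∈))) t₁<t₂
        t₂≤ : t₂ ≤ length (x₂ ∷ concat bs)
        t₂≤ = subst (t₂ ≤_) (sym (trans (cong length π≡) (↭range⇒length n π↭))) (proj₂ (∈-range⁻ t₂∈))

-- The first entry of π and a later singleton block [v] form an occurrence.
lateSingleton⇒occurrence : ∀ n {π} → π ↭ range n → T (lateSingleton π) → Occurrence n π
lateSingleton⇒occurrence n {π} π↭ late
  with h , t , pre , v , post , eq , _ ← lateSingleton-blocks (↭range⇒standard n π↭) late = record
  { x₁<x₂    = h<v
  ; t₁<t₂    = s≤s (s≤s z≤n)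
  ; x₁∈      = ∈-resp-↭ π↭ (subst (h ∈_) (sym π≡) (here refl))
  ; x₂∈      = v∈range
  ; t₁∈      = ∈-range⁺ ≤-refl (≤-trans (s≤s z≤n) t₂≤n)
  ; t₂∈      = ∈-range⁺ (s≤s z≤n) t₂≤n
  ; π[t₁]≡x₁ = cong (λ τ → at τ 1) π≡
  ; π[t₂]≡x₂ = trans (cong (λ τ → at τ (suc (suc i))) π≡) rest[i]≡v
  ; x₂-fixed = Equivalence.from (hat-fixedPoint n π↭ v∈range) (subst ([ v ] ∈_) (sym eq) (there v∈bs))
  }
  where
    bs : List (List ℕ)
    bs = pre ++ [ v ] ∷ post
    v∈bs : [ v ] ∈ bs
    v∈bs = ∈-++⁺ʳ pre (here refl)
    h<v : h < v
    h<v with block _ _ std ← subst (StandardForm 0) eq (↭range⇒standard n π↭) =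
      All.lookup (proj₁ (standard-heads std)) (∈-heads⁺ v∈bs)
    π≡ : π ≡ h ∷ t ++ concat bs
    π≡ = trans (sym (concat∘blocks π)) (cong concat eq)
    v∈rest : v ∈ t ++ concat bs
    v∈rest = ∈-++⁺ʳ t (∈-concat⁺′ (here refl) v∈bs)
    v∈range : v ∈ range n
    v∈range = ∈-resp-↭ π↭ (subst (v ∈_) (sym π≡) (there v∈rest))
    i : ℕ
    i = proj₁ (∈⇒at v∈rest)
    rest[i]≡v : at (t ++ concat bs) (suc i) ≡ v
    rest[i]≡v = proj₂ (proj₂ (∈⇒at v∈rest))
    t₂≤n : suc (suc i) ≤ n
    t₂≤n = subst (suc (suc i) ≤_) (trans (cong length (sym π≡)) (↭range⇒length n π↭))
                 (s≤s (proj₁ (proj₂ (∈⇒at v∈rest))))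

containsᵇ≡lateSingleton : ∀ n {π} → π ∈ Sym n → containsᵇ n p12-2→2 π ≡ lateSingleton π
containsᵇ≡lateSingleton n {π} π∈ = T-injective {containsᵇ n p12-2→2 π} {lateSingleton π} (mk⇔
  (λ c → occurrence⇒lateSingleton n (Sym⁻ n π∈) (containsᵇ⇒occurrence n π∈ c))
  (λ l → occurrence⇒containsᵇ n π∈ (lateSingleton⇒occurrence n (Sym⁻ n π∈) l)))

-- Moving the last late singleton block to the front

-- acc is the concatenation of the blocks already passed; the last singleton block [v]
-- absorbs all of them into the block v ∷ acc.
gatherInto : List ℕ → List (List ℕ) → List (List ℕ)
gatherInto acc []                 = []
gatherInto acc ([] ∷ bs)          = gatherInto acc bs
gatherInto acc ((v ∷ []) ∷ bs)    = if hasSingleton bs then gatherInto (acc ++ [ v ]) bs else (v ∷ acc) ∷ bs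
gatherInto acc ((x ∷ y ∷ t) ∷ bs) = gatherInto (acc ++ x ∷ y ∷ t) bs

scatter : List (List ℕ) → List (List ℕ)
scatter ((v ∷ rest) ∷ bs) = blocks rest ++ [ v ] ∷ bs
scatter bs                = bs

toSingletonFree : List ℕ → List ℕ
toSingletonFree π = concat (gatherInto [] (blocks π))

fromSingletonFree : List ℕ → List ℕ
fromSingletonFree π = concat (scatter (blocks π))

gatherInto-lastSingleton : ∀ acc pre {v post} → T (not (hasSingleton post)) →
  gatherInto acc (pre ++ [ v ] ∷ post) ≡ (v ∷ acc ++ concat pre) ∷ post
gatherInto-lastSingleton acc [] {v} {post} free rewrite Equivalence.to (T-not-≡ {hasSingleton post}) free =
  cong (λ xs → (v ∷ xs) ∷ post) (sym (++-identityʳ acc))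
gatherInto-lastSingleton acc ([] ∷ pre) free = gatherInto-lastSingleton acc pre free
gatherInto-lastSingleton acc ((u ∷ []) ∷ pre) {v} {post} free
  rewrite Equivalence.to T-≡ (hasSingleton⁺ {v} {pre ++ [ v ] ∷ post} (∈-++⁺ʳ pre (here refl))) =
  trans (gatherInto-lastSingleton (acc ++ [ u ]) pre free) (cong (λ xs → (v ∷ xs) ∷ post) (++-assoc acc [ u ] (concat pre)))
gatherInto-lastSingleton acc ((x ∷ y ∷ t) ∷ pre) {v} {post} free =
  trans (gatherInto-lastSingleton (acc ++ x ∷ y ∷ t) pre free)
        (cong (λ xs → (v ∷ xs) ∷ post) (++-assoc acc (x ∷ y ∷ t) (concat pre)))

toSingletonFree-correct : ∀ n {π} → π ∈ filterᵇ lateSingleton (Sym n) →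
  toSingletonFree π ∈ filterᵇ singletonFree (Sym n) × fromSingletonFree (toSingletonFree π) ≡ π
toSingletonFree-correct n {π} π∈ with π∈Sym , late ← ∈-filterᵇ⁻ π∈
  with h , t , pre , v , post , eq , free ← lateSingleton-blocks (↭range⇒standard n (Sym⁻ n π∈Sym)) late =
  ∈-filterᵇ⁺ (Sym⁺ n ↭range) free′ , inverse
  where
    π↭ : π ↭ range n
    π↭ = Sym⁻ n π∈Sym
    cs : List (List ℕ)
    cs = (h ∷ t) ∷ pre
    gathered : List (List ℕ)
    gathered = (v ∷ concat cs) ∷ post
    std : StandardForm 0 (cs ++ [ v ] ∷ post)
    std = subst (StandardForm 0) eq (↭range⇒standard n π↭)
    π≡ : concat (cs ++ [ v ] ∷ post) ≡ π
    π≡ = trans (cong concat (sym eq)) (concat∘blocks π)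
    π′≡ : toSingletonFree π ≡ concat gathered
    π′≡ = cong concat (trans (cong (gatherInto []) eq) (gatherInto-lastSingleton [] cs free))
    blocks-π′ : blocks (toSingletonFree π) ≡ gathered
    blocks-π′ = trans (cong blocks π′≡) (blocks∘concat (standard-gather cs std))
    ↭range : toSingletonFree π ↭ range n
    ↭range = begin
      toSingletonFree π                 ≡⟨ π′≡ ⟩
      v ∷ concat cs ++ concat post      ↭⟨ ↭-sym (shift v (concat cs) (concat post)) ⟩
      concat cs ++ [ v ] ++ concat post ≡⟨ concat-++ cs ([ v ] ∷ post) ⟩
      concat (cs ++ [ v ] ∷ post)       ≡⟨ π≡ ⟩
      π                                 ↭⟨ π↭ ⟩
      range n                           ∎
      where open PermutationReasoning
    free′ : T (singletonFree (toSingletonFree π))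
    free′ = subst (T ∘ not ∘ hasSingleton) (sym blocks-π′) free
    inverse : fromSingletonFree (toSingletonFree π) ≡ π
    inverse = begin
      concat (scatter (blocks (toSingletonFree π))) ≡⟨ cong (concat ∘ scatter) blocks-π′ ⟩
      concat (blocks (concat cs) ++ [ v ] ∷ post)   ≡⟨ cong (λ bs → concat (bs ++ [ v ] ∷ post))
                                                         (blocks∘concat (standard-++ˡ cs std)) ⟩
      concat (cs ++ [ v ] ∷ post)                   ≡⟨ π≡ ⟩
      π                                             ∎
      where open ≡-Reasoning

concat-scatter-↭ : ∀ bs → concat (scatter bs) ↭ concat bs
concat-scatter-↭ []                = ↭-refl
concat-scatter-↭ ([] ∷ bs)         = ↭-refl
concat-scatter-↭ ((v ∷ rest) ∷ bs) = begin
  concat (blocks rest ++ [ v ] ∷ bs)         ≡⟨ sym (concat-++ (blocks rest) ([ v ] ∷ bs)) ⟩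
  concat (blocks rest) ++ [ v ] ++ concat bs ≡⟨ cong (_++ v ∷ concat bs) (concat∘blocks rest) ⟩
  rest ++ [ v ] ++ concat bs                 ↭⟨ shift v rest (concat bs) ⟩
  v ∷ rest ++ concat bs                      ∎
  where open PermutationReasoning

blocks∘fromSingletonFree : ∀ n {π v r rs bs} → π ↭ range n → blocks π ≡ (v ∷ r ∷ rs) ∷ bs →
  blocks (fromSingletonFree π) ≡ blocks (r ∷ rs) ++ [ v ] ∷ bs
blocks∘fromSingletonFree n {π} {v} {r} {rs} {bs} π↭ eq =
  trans (cong (blocks ∘ concat ∘ scatter) eq) (blocks∘concat (standard-scatter std-rest std))
  where
    π≡ : π ≡ v ∷ (r ∷ rs) ++ concat bs
    π≡ = trans (sym (concat∘blocks π)) (cong concat eq)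
    std-rest : StandardForm 0 (blocks (r ∷ rs))
    std-rest = standard-blocks (proj₁ (Unique-++⁻ (r ∷ rs) (AllPairs.tail (subst Unique π≡ (↭range⇒Unique n π↭)))))
      (All.tabulate λ z∈ → proj₁ (∈-range⁻ (∈-resp-↭ π↭ (subst (_ ∈_) (sym π≡) (there (∈-++⁺ˡ z∈))))))
    std : StandardForm 0 ((v ∷ concat (blocks (r ∷ rs))) ∷ bs)
    std = subst (λ xs → StandardForm 0 ((v ∷ xs) ∷ bs)) (sym (concat∘blocks (r ∷ rs)))
                (subst (StandardForm 0) eq (↭range⇒standard n π↭))

fromSingletonFree-correct : ∀ n {π} → 1 ≤ n → π ∈ filterᵇ singletonFree (Sym n) →
  fromSingletonFree π ∈ filterᵇ lateSingleton (Sym n) × toSingletonFree (fromSingletonFree π) ≡ π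
fromSingletonFree-correct n {π} 1≤n π∈ with π∈Sym , free ← ∈-filterᵇ⁻ π∈
  with v , r , rs , bs , eq , free′ ← singletonFree-blocks (↭range⇒standard n (Sym⁻ n π∈Sym))
                                                           (↭range⇒blocks≢[] n 1≤n (Sym⁻ n π∈Sym)) free =
  ∈-filterᵇ⁺ (Sym⁺ n ↭range) late , inverse
  where
    π↭ : π ↭ range n
    π↭ = Sym⁻ n π∈Sym
    c : List ℕ
    c = proj₁ (blocks-∷ r rs)
    cs : List (List ℕ)
    cs = proj₁ (proj₂ (blocks-∷ r rs))
    blocks-rest : blocks (r ∷ rs) ≡ c ∷ cs
    blocks-rest = proj₂ (proj₂ (blocks-∷ r rs))
    blocks-π″ : blocks (fromSingletonFree π) ≡ (c ∷ cs) ++ [ v ] ∷ bs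
    blocks-π″ = trans (blocks∘fromSingletonFree n π↭ eq) (cong (_++ [ v ] ∷ bs) blocks-rest)
    ↭range : fromSingletonFree π ↭ range n
    ↭range = ↭-trans (concat-scatter-↭ (blocks π)) (subst (_↭ range n) (sym (concat∘blocks π)) π↭)
    late : T (lateSingleton (fromSingletonFree π))
    late = subst (T ∘ hasSingleton ∘ drop 1) (sym blocks-π″) (hasSingleton⁺ (∈-++⁺ʳ cs (here refl)))
    inverse : toSingletonFree (fromSingletonFree π) ≡ π
    inverse = begin
      concat (gatherInto [] (blocks (fromSingletonFree π)))
        ≡⟨ cong (concat ∘ gatherInto []) blocks-π″ ⟩
      concat (gatherInto [] ((c ∷ cs) ++ [ v ] ∷ bs))
        ≡⟨ cong concat (gatherInto-lastSingleton [] (c ∷ cs) free′) ⟩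
      v ∷ concat (c ∷ cs) ++ concat bs
        ≡⟨ cong (λ xs → v ∷ concat xs ++ concat bs) (sym blocks-rest) ⟩
      v ∷ concat (blocks (r ∷ rs)) ++ concat bs
        ≡⟨ cong (λ xs → v ∷ xs ++ concat bs) (concat∘blocks (r ∷ rs)) ⟩
      v ∷ (r ∷ rs) ++ concat bs
        ≡⟨ trans (cong concat (sym eq)) (concat∘blocks π) ⟩
      π ∎
      where open ≡-Reasoning

fixedPointFree∘hat : ∀ n {π} → π ↭ range n → fixedPointFree n (hat n π) ≡ singletonFree π
fixedPointFree∘hat n {π} π↭ = T-injective {fixedPointFree n (hat n π)} {singletonFree π} (mk⇔ fpf⇒free free⇒fpf)
  where
    fpf⇒free : T (fixedPointFree n (hat n π)) → T (singletonFree π)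
    fpf⇒free fpf = Equivalence.from T-not λ has →
      let v , v∈ = hasSingleton⁻ has
          v∈range = ∈-resp-↭ π↭ (subst (v ∈_) (concat∘blocks π) (∈-concat⁺′ (here refl) v∈))
      in Equivalence.to T-not (All.lookup (allᵇ⁻ fpf) v∈range)
           (≡⇒≡ᵇ _ _ (Equivalence.from (hat-fixedPoint n π↭ v∈range) v∈))
    free⇒fpf : T (singletonFree π) → T (fixedPointFree n (hat n π))
    free⇒fpf free = allᵇ⁺ (All.tabulate λ i∈ → Equivalence.from T-not λ fixed →
      Equivalence.to T-not free (hasSingleton⁺ (Equivalence.to (hat-fixedPoint n π↭ i∈) (≡ᵇ⇒≡ _ _ fixed))))

length-singletonFree : ∀ n → length (filterᵇ singletonFree (Sym n)) ≡ d n
length-singletonFree n = begin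
  length (filterᵇ singletonFree (Sym n))              ≡⟨ cong length (filterᵇ-cong (Sym n) λ π∈ →
                                                           sym (fixedPointFree∘hat n (Sym⁻ n π∈))) ⟩
  length (filterᵇ (fixedPointFree n ∘ hat n) (Sym n)) ≡⟨ length-filterᵇ-∘ (≡-dec _≟_) (hat n) (θ n) (fixedPointFree n)
                                                           (Unique-Sym n) (λ π∈ → Sym⁺ n (hat-↭ n (Sym⁻ n π∈)))
                                                           (λ π∈ → θ∘hat n (Sym⁻ n π∈)) ⟩
  d n                                                 ∎
  where open ≡-Reasoning

length-lateSingleton : ∀ n → 1 ≤ n → length (filterᵇ lateSingleton (Sym n)) ≡ d n
length-lateSingleton n 1≤n = trans
  (inverse⇒length≡ (≡-dec _≟_) toSingletonFree fromSingletonFree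
     (Unique-filterᵇ (Unique-Sym n)) (Unique-filterᵇ (Unique-Sym n))
     (λ π∈ → proj₁ (toSingletonFree-correct n π∈)) (λ π∈ → proj₁ (fromSingletonFree-correct n 1≤n π∈))
     (λ π∈ → proj₂ (toSingletonFree-correct n π∈)) (λ π∈ → proj₂ (fromSingletonFree-correct n 1≤n π∈)))
  (length-singletonFree n)

theorem3p2 : (n : ℕ) → 1 ≤ n → a p12-2→2 n ≡ n ! ∸ d n
theorem3p2 n 1≤n = begin
  a p12-2→2 n
    ≡⟨ cong length (filterᵇ-cong (Sym n) λ π∈ → cong not (containsᵇ≡lateSingleton n π∈)) ⟩
  length avoiders
    ≡⟨ sym (m+n∸m≡n (d n) (length avoiders)) ⟩
  d n + length avoiders ∸ d n
    ≡⟨ cong (λ k → k + length avoiders ∸ d n) (sym (length-lateSingleton n 1≤n)) ⟩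
  length containers + length avoiders ∸ d n
    ≡⟨ cong (_∸ d n) (trans (length-filterᵇ-not lateSingleton (Sym n)) (length-Sym n)) ⟩
  n ! ∸ d n ∎
  where
    open ≡-Reasoning
    containers avoiders : List (List ℕ)
    containers = filterᵇ lateSingleton (Sym n)
    avoiders   = filterᵇ (not ∘ lateSingleton) (Sym n)
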